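{- Let $a,b$ be positive integers and let $\alpha$ be a real number with $\frac{1}{2}\leq \alpha<1$. Then there is $r_0>0$ (depending on $a$, $b$, $\alpha$) such that for every $r\geq r_0$ and every $r$-regular graph $G$ with $n$ vertices, $\gamma_{a,b}(G)\leq \alpha n$.
   Context: All graphs are finite and simple. For positive integers $a,b$, an $(a,b)$-dominating set of a graph $G$ is a subset $S\subseteq V(G)$ such that every vertex $v\in S$ is adjacent to at least $a$ vertices of $S$ and every vertex $v\in V(G)\setminus S$ is adjacent to at least $b$ vertices of $S$. $\gamma_{a,b}(G)$ denotes the minimum cardinality of an $(a,b)$-dominating set of $G$.
   Formalization: The parameter α with $\frac{1}{2}\leq \alpha<1$ ranges over the rationals rather than the reals. -}

module Defs where

open import Data.Nat using (ℕ; zero; suc; _+_; _≤_)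
open import Data.Fin using (Fin; zero; suc)
open import Data.Bool using (Bool; true; false; _∧_)
open import Data.Product using (_×_)
open import Relation.Binary.PropositionalEquality using (_≡_)

record Graph (n : ℕ) : Set where
  field
    adj    : Fin n → Fin n → Bool
    sym    : ∀ u v → adj u v ≡ adj v u
    irrefl : ∀ v → adj v v ≡ false
open Graph public

countTrue : ∀ {n} → (Fin n → Bool) → ℕ
countTrue {zero}  f = 0
countTrue {suc n} f with f zero
... | true  = suc (countTrue (λ i → f (suc i)))
... | false = countTrue (λ i → f (suc i))

VSet : ℕ → Set
VSet n = Fin n → Bool

∣_∣ : ∀ {n} → VSet n → ℕ
∣ S ∣ = countTrue S

degree : ∀ {n} → Graph n → Fin n → ℕ
degree G v = countTrue (adj G v)

Regular : ∀ {n} → ℕ → Graph n → Set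
Regular r G = ∀ v → degree G v ≡ r

nbrsIn : ∀ {n} → Graph n → VSet n → Fin n → ℕ
nbrsIn G S v = countTrue (λ u → adj G v u ∧ S u)

IsABDominating : ∀ {n} → ℕ → ℕ → Graph n → VSet n → Set
IsABDominating a b G S =
  ∀ v → (S v ≡ true → a ≤ nbrsIn G S v) × (S v ≡ false → b ≤ nbrsIn G S v)

module Submission where

-- With c = a + b it suffices to find a set S with 2|S| ≤ n in which every vertex has
-- at least c neighbours (dense⇒dominating, halfBound).  Such an S comes from the
-- probabilistic method, made finite by averaging over all 4ⁿ colourings f of the
-- vertices with four colours:
--   * Repair: adding at most c vertices per vertex lacking c neighbours in the set Z_f
--     of c₀-coloured vertices yields S with |S| ≤ |Z_f| + c·|B_f|, B_f the deficient set.
--   * Colourings / Expectations: summed over all f (double counting over vertices),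
--     Σ|Z_f| = n·4ⁿ/4 and Σ|B_f| = n·4ⁿ·fewC₀(r,c)/4^r, where fewC₀(r,c) counts the
--     words of length r with fewer than c letters c₀ (the Bin(r,¼) tail).
--   * TailBound: 4c·fewC₀(r,c) ≤ 4^r for r large, so Σ_f (2|Z_f| + 2c|B_f|) ≤ n·4ⁿ and
--     some colouring f has 2|Z_f| + 2c|B_f| ≤ n (DenseSet).

module Counting where
  open import Defs using (countTrue)
  open import Data.Nat
  open import Data.Nat.Properties
  open import Data.Fin using (Fin; zero; suc)
  open import Data.Fin.Properties using () renaming (_≟_ to _≟ᶠ_)
  open import Data.Bool using (Bool; true; false; _∨_)
  open import Data.Product using (Σ; _×_; _,_)
  open import Relation.Nullary using (does)
  open import Relation.Binary.PropositionalEquality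
  open import Algebra.Properties.CommutativeSemigroup +-commutativeSemigroup
    using () renaming (interchange to +-interchange)

  ind : Bool → ℕ
  ind true  = 1
  ind false = 0

  ind≤1 : ∀ x → ind x ≤ 1
  ind≤1 true  = ≤-refl
  ind≤1 false = z≤n

  countTrue-suc : ∀ {n} (f : Fin (suc n) → Bool) →
    countTrue f ≡ ind (f zero) + countTrue (λ i → f (suc i))
  countTrue-suc f with f zero
  ... | true  = refl
  ... | false = refl

  countTrue-false : ∀ {n} → countTrue {n} (λ _ → false) ≡ 0
  countTrue-false {zero}  = refl
  countTrue-false {suc n} = countTrue-false {n}

  ind-mono : ∀ {x y} → (x ≡ true → y ≡ true) → ind x ≤ ind y
  ind-mono {false} _   = z≤n
  ind-mono {true}  x⇒y rewrite x⇒y refl = ≤-refl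

  countTrue-mono : ∀ {n} (f g : Fin n → Bool) → (∀ i → f i ≡ true → g i ≡ true) →
    countTrue f ≤ countTrue g
  countTrue-mono {zero}  f g f⇒g = z≤n
  countTrue-mono {suc n} f g f⇒g rewrite countTrue-suc f | countTrue-suc g =
    +-mono-≤ (ind-mono (f⇒g zero)) (countTrue-mono _ _ (λ i → f⇒g (suc i)))

  countTrue-strict : ∀ {n} (f g : Fin n → Bool) → (∀ i → f i ≡ true → g i ≡ true) →
    (u : Fin n) → f u ≡ false → g u ≡ true → countTrue f < countTrue g
  countTrue-strict {suc n} f g f⇒g zero fu gu rewrite countTrue-suc f | countTrue-suc g | fu | gu =
    s≤s (countTrue-mono _ _ (λ i → f⇒g (suc i)))
  countTrue-strict {suc n} f g f⇒g (suc u) fu gu rewrite countTrue-suc f | countTrue-suc g =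
    +-mono-≤-< (ind-mono (f⇒g zero)) (countTrue-strict _ _ (λ i → f⇒g (suc i)) u fu gu)

  countTrue-witness : ∀ {n} (f g : Fin n → Bool) → countTrue f < countTrue g →
    Σ (Fin n) λ u → g u ≡ true × f u ≡ false
  countTrue-witness {zero} f g ()
  countTrue-witness {suc n} f g f<g =
    split (f zero) (g zero) refl refl (subst₂ _<_ (countTrue-suc f) (countTrue-suc g) f<g)
    where
    f′ g′ : Fin n → Bool
    f′ i = f (suc i)
    g′ i = g (suc i)
    inTail : countTrue f′ < countTrue g′ → Σ (Fin (suc n)) λ u → g u ≡ true × f u ≡ false
    inTail lt with countTrue-witness f′ g′ lt
    ... | u , gu , fu = suc u , gu , fu
    split : ∀ x y → f zero ≡ x → g zero ≡ y → ind x + countTrue f′ < ind y + countTrue g′ →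
      Σ (Fin (suc n)) λ u → g u ≡ true × f u ≡ false
    split false true  fz gz _          = zero , gz , fz
    split true  true  _  _  (s≤s lt)   = inTail lt
    split false false _  _  lt         = inTail lt
    split true  false _  _  lt         = inTail (<-trans (n<1+n _) lt)

  countTrue-∨ : ∀ {n} (f g : Fin n → Bool) →
    countTrue (λ i → f i ∨ g i) ≤ countTrue f + countTrue g
  countTrue-∨ {zero}  f g = z≤n
  countTrue-∨ {suc n} f g
    rewrite countTrue-suc (λ i → f i ∨ g i) | countTrue-suc f | countTrue-suc g =
    begin
      ind (f zero ∨ g zero) + countTrue (λ i → f (suc i) ∨ g (suc i))
        ≤⟨ +-mono-≤ (ind-∨ (f zero) (g zero)) (countTrue-∨ f′ g′) ⟩
      (ind (f zero) + ind (g zero)) + (countTrue f′ + countTrue g′)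
        ≡⟨ +-interchange (ind (f zero)) (ind (g zero)) (countTrue f′) (countTrue g′) ⟩
      (ind (f zero) + countTrue f′) + (ind (g zero) + countTrue g′) ∎
    where
    open ≤-Reasoning
    f′ g′ : Fin n → Bool
    f′ i = f (suc i)
    g′ i = g (suc i)
    ind-∨ : ∀ x y → ind (x ∨ y) ≤ ind x + ind y
    ind-∨ true  y = s≤s z≤n
    ind-∨ false y = ≤-refl

  countTrue-singleton : ∀ {n} (u : Fin n) → countTrue (λ w → does (w ≟ᶠ u)) ≤ 1
  countTrue-singleton {suc n} zero    = s≤s (≤-reflexive (countTrue-false {n}))
  countTrue-singleton {suc n} (suc u) = countTrue-singleton u

module Repair where
  open import Defs using (Graph; adj; VSet; ∣_∣; countTrue; degree; nbrsIn)
  open Counting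
  open import Data.Nat
  open import Data.Nat.Properties
  open import Data.Fin using (Fin; zero; suc)
  open import Data.Fin.Properties using () renaming (_≟_ to _≟ᶠ_)
  open import Data.Bool using (Bool; true; false; T; _∧_; _∨_)
  open import Data.Bool.Properties using (∨-zeroʳ)
  open import Data.Product using (Σ; _×_; _,_)
  open import Relation.Nullary using (does; yes; no)
  open import Relation.Nullary.Decidable using (dec-true)
  open import Relation.Binary.PropositionalEquality

  _⊆_ : ∀ {n} → VSet n → VSet n → Set
  S ⊆ T = ∀ u → S u ≡ true → T u ≡ true

  ⊆-refl : ∀ {n} {S : VSet n} → S ⊆ S
  ⊆-refl u Su = Su

  ⊆-trans : ∀ {n} {S T U : VSet n} → S ⊆ T → T ⊆ U → S ⊆ U
  ⊆-trans S⊆T T⊆U u Su = T⊆U u (S⊆T u Su)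

  insert : ∀ {n} → VSet n → Fin n → VSet n
  insert S u w = S w ∨ does (w ≟ᶠ u)

  ⊆-insert : ∀ {n} (S : VSet n) u → S ⊆ insert S u
  ⊆-insert S u w Sw rewrite Sw = refl

  insert-∋ : ∀ {n} (S : VSet n) u → insert S u u ≡ true
  insert-∋ S u rewrite dec-true (u ≟ᶠ u) refl = ∨-zeroʳ (S u)

  ∣insert∣≤ : ∀ {n} (S : VSet n) u → ∣ insert S u ∣ ≤ suc ∣ S ∣
  ∣insert∣≤ S u = begin
    ∣ insert S u ∣                          ≤⟨ countTrue-∨ S (λ w → does (w ≟ᶠ u)) ⟩
    ∣ S ∣ + countTrue (λ w → does (w ≟ᶠ u)) ≤⟨ +-monoʳ-≤ ∣ S ∣ (countTrue-singleton u) ⟩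
    ∣ S ∣ + 1                               ≡⟨ +-comm ∣ S ∣ 1 ⟩
    suc ∣ S ∣                               ∎
    where open ≤-Reasoning

  ∧-monoʳ : ∀ {x y z} → (y ≡ true → z ≡ true) → x ∧ y ≡ true → x ∧ z ≡ true
  ∧-monoʳ {true} y⇒z = y⇒z

  <ᵇ-false : ∀ m c → (m <ᵇ c) ≡ false → c ≤ m
  <ᵇ-false m c m≮c = ≮⇒≥ (λ m<c → subst T m≮c (<⇒<ᵇ m<c))

  module _ {n} (G : Graph n) where

    nbrsIn-mono : ∀ {S T} → S ⊆ T → ∀ v → nbrsIn G S v ≤ nbrsIn G T v
    nbrsIn-mono S⊆T v = countTrue-mono _ _ (λ u → ∧-monoʳ (S⊆T u))

    nbrsIn-insert : ∀ S v u → adj G v u ≡ true → S u ≡ false →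
      nbrsIn G S v < nbrsIn G (insert S u) v
    nbrsIn-insert S v u vu Su = countTrue-strict _ _ (λ w → ∧-monoʳ (⊆-insert S u w)) u
      (subst (λ x → x ∧ S u ≡ false) (sym vu) Su)
      (subst (λ x → x ∧ insert S u u ≡ true) (sym vu) (insert-∋ S u))

    topUp : ∀ c d S v → c ≤ degree G v → c ≤ nbrsIn G S v + d →
      Σ (VSet n) λ S′ → S ⊆ S′ × c ≤ nbrsIn G S′ v × ∣ S′ ∣ ≤ ∣ S ∣ + d
    topUp c zero S v _ enough =
      S , ⊆-refl , subst (c ≤_) (+-identityʳ _) enough , m≤m+n ∣ S ∣ 0
    topUp c (suc d) S v deg enough with c ≤? nbrsIn G S v
    ... | yes ok = S , ⊆-refl , ok , m≤m+n ∣ S ∣ (suc d)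
    ... | no short with countTrue-witness (λ u → adj G v u ∧ S u) (adj G v) (<-≤-trans (≰⇒> short) deg)
    ... | u , vu , vu∧Su with topUp c d (insert S u) v deg enough′
      where
      Su : S u ≡ false
      Su = subst (λ x → x ∧ S u ≡ false) vu vu∧Su
      enough′ : c ≤ nbrsIn G (insert S u) v + d
      enough′ = ≤-trans enough (≤-trans (≤-reflexive (+-suc _ d))
                  (+-monoˡ-≤ d (nbrsIn-insert S v u vu Su)))
    ... | S′ , S⊆S′ , ok , size =
      S′ , ⊆-trans (⊆-insert S u) S⊆S′ , ok ,
      ≤-trans size (≤-trans (+-monoˡ-≤ d (∣insert∣≤ S u)) (≤-reflexive (sym (+-suc ∣ S ∣ d))))

    deficient : ℕ → VSet n → VSet n
    deficient c S v = nbrsIn G S v <ᵇ c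

    repairOne : ∀ c S₀ S v → c ≤ degree G v → S₀ ⊆ S → ∀ x → deficient c S₀ v ≡ x →
      Σ (VSet n) λ S₁ → S ⊆ S₁ × c ≤ nbrsIn G S₁ v × ∣ S₁ ∣ ≤ ∣ S ∣ + c * ind x
    repairOne c S₀ S v deg S₀⊆S false fine =
      S , ⊆-refl , ≤-trans (<ᵇ-false _ c fine) (nbrsIn-mono S₀⊆S v) , m≤m+n ∣ S ∣ _
    repairOne c S₀ S v deg S₀⊆S true _ with topUp c c S v deg (m≤n+m c _)
    ... | S₁ , S⊆S₁ , ok , size =
      S₁ , S⊆S₁ , ok , subst (λ m → ∣ S₁ ∣ ≤ ∣ S ∣ + m) (sym (*-identityʳ c)) size

    repairListed : ∀ c k (ι : Fin k → Fin n) S₀ S → (∀ v → c ≤ degree G v) → S₀ ⊆ S →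
      Σ (VSet n) λ S′ → S ⊆ S′ × (∀ j → c ≤ nbrsIn G S′ (ι j)) ×
        ∣ S′ ∣ ≤ ∣ S ∣ + c * countTrue (λ j → deficient c S₀ (ι j))
    repairListed c zero ι S₀ S deg S₀⊆S = S , ⊆-refl , (λ ()) , m≤m+n ∣ S ∣ _
    repairListed c (suc k) ι S₀ S deg S₀⊆S
      with repairOne c S₀ S (ι zero) (deg (ι zero)) S₀⊆S _ refl
    ... | S₁ , S⊆S₁ , ok₁ , size₁
      with repairListed c k (λ j → ι (suc j)) S₀ S₁ deg (⊆-trans S₀⊆S S⊆S₁)
    ... | S′ , S₁⊆S′ , ok , size =
      S′ , ⊆-trans S⊆S₁ S₁⊆S′ ,
      (λ { zero → ≤-trans ok₁ (nbrsIn-mono S₁⊆S′ (ι zero)) ; (suc j) → ok j }) ,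
      (begin
        ∣ S′ ∣                              ≤⟨ size ⟩
        ∣ S₁ ∣ + c * rest                   ≤⟨ +-monoˡ-≤ (c * rest) size₁ ⟩
        ∣ S ∣ + c * ind first + c * rest    ≡⟨ +-assoc ∣ S ∣ _ _ ⟩
        ∣ S ∣ + (c * ind first + c * rest)  ≡⟨ cong (∣ S ∣ +_) (*-distribˡ-+ c _ rest) ⟨
        ∣ S ∣ + c * (ind first + rest)
          ≡⟨ cong (λ m → ∣ S ∣ + c * m) (countTrue-suc (λ j → deficient c S₀ (ι j))) ⟨
        ∣ S ∣ + c * countTrue (λ j → deficient c S₀ (ι j)) ∎)
      where
      open ≤-Reasoning
      first : Bool
      first = deficient c S₀ (ι zero)
      rest : ℕ
      rest = countTrue (λ j → deficient c S₀ (ι (suc j)))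

    repair : ∀ c S → (∀ v → c ≤ degree G v) →
      Σ (VSet n) λ S′ → (∀ v → c ≤ nbrsIn G S′ v) × ∣ S′ ∣ ≤ ∣ S ∣ + c * ∣ deficient c S ∣
    repair c S deg with repairListed c n (λ v → v) S S deg ⊆-refl
    ... | S′ , _ , ok , size = S′ , ok , size

module Colourings where
  open import Defs using (VSet)
  open import Data.Nat
  open import Data.Nat.Properties
  open import Data.Nat.Tactic.RingSolver using (solve-∀)
  open import Data.Bool using (Bool; true; false)
  open import Data.Sum using (inj₁; inj₂)
  open import Data.Product using (Σ; _×_; _,_)
  open import Data.Vec.Functional using (Vector; []; _∷_)
  open import Relation.Binary.PropositionalEquality

  -- Four colours; the vertices of colour c₀ form the random set.
  data Colour : Set where
    c₀ c₁ c₂ c₃ : Colour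

  isC₀ : Colour → Bool
  isC₀ c₀ = true
  isC₀ c₁ = false
  isC₀ c₂ = false
  isC₀ c₃ = false

  Colouring : ℕ → Set
  Colouring n = Vector Colour n

  chosen : ∀ {n} → Colouring n → VSet n
  chosen f u = isC₀ (f u)

  sum4 : (Colour → ℕ) → ℕ
  sum4 x = x c₀ + x c₁ + x c₂ + x c₃

  sum4-cong : ∀ {x y : Colour → ℕ} → (∀ i → x i ≡ y i) → sum4 x ≡ sum4 y
  sum4-cong x≗y = cong₂ _+_ (cong₂ _+_ (cong₂ _+_ (x≗y c₀) (x≗y c₁)) (x≗y c₂)) (x≗y c₃)

  sum4-+ : ∀ (x y : Colour → ℕ) → sum4 (λ i → x i + y i) ≡ sum4 x + sum4 y
  sum4-+ x y = lemma (x c₀) (x c₁) (x c₂) (x c₃) (y c₀) (y c₁) (y c₂) (y c₃)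
    where
    lemma : ∀ a b c d e f g h → a + e + (b + f) + (c + g) + (d + h) ≡ a + b + c + d + (e + f + g + h)
    lemma = solve-∀

  sum4-* : ∀ k (x : Colour → ℕ) → sum4 (λ i → k * x i) ≡ k * sum4 x
  sum4-* k x = sym (lemma k (x c₀) (x c₁) (x c₂) (x c₃))
    where
    lemma : ∀ k a b c d → k * (a + b + c + d) ≡ k * a + k * b + k * c + k * d
    lemma = solve-∀

  sum4-const : ∀ k → sum4 (λ _ → k) ≡ 4 * k
  sum4-const k = sym (lemma k)
    where
    lemma : ∀ k → 4 * k ≡ k + k + k + k
    lemma = solve-∀

  argmin₂ : ∀ (x : Colour → ℕ) i j → Σ Colour λ k → x k ≤ x i × x k ≤ x j
  argmin₂ x i j with ≤-total (x i) (x j)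
  ... | inj₁ xi≤xj = i , ≤-refl , xi≤xj
  ... | inj₂ xj≤xi = j , xj≤xi , ≤-refl

  sum4-min : ∀ (x : Colour → ℕ) → Σ Colour λ i → 4 * x i ≤ sum4 x
  sum4-min x with argmin₂ x c₀ c₁ | argmin₂ x c₂ c₃
  ... | i , i≤c₀ , i≤c₁ | j , j≤c₂ , j≤c₃ with argmin₂ x i j
  ... | k , k≤i , k≤j =
    k , ≤-trans (≤-reflexive (lemma (x k)))
          (+-mono-≤ (+-mono-≤ (+-mono-≤ (≤-trans k≤i i≤c₀) (≤-trans k≤i i≤c₁))
                              (≤-trans k≤j j≤c₂)) (≤-trans k≤j j≤c₃))
    where
    lemma : ∀ m → 4 * m ≡ m + m + m + m
    lemma = solve-∀

  slice : ∀ {n} → (Colouring (suc n) → ℕ) → Colour → Colouring n → ℕ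
  slice h i g = h (i ∷ g)

  ∑ᶜ : ∀ n → (Colouring n → ℕ) → ℕ
  ∑ᶜ zero    h = h []
  ∑ᶜ (suc n) h = sum4 (λ i → ∑ᶜ n (slice h i))

  ∑ᶜ-cong : ∀ n {h k : Colouring n → ℕ} → (∀ f → h f ≡ k f) → ∑ᶜ n h ≡ ∑ᶜ n k
  ∑ᶜ-cong zero    h≗k = h≗k []
  ∑ᶜ-cong (suc n) h≗k = sum4-cong (λ i → ∑ᶜ-cong n (λ g → h≗k (i ∷ g)))

  ∑ᶜ-+ : ∀ n (h k : Colouring n → ℕ) → ∑ᶜ n (λ f → h f + k f) ≡ ∑ᶜ n h + ∑ᶜ n k
  ∑ᶜ-+ zero    h k = refl
  ∑ᶜ-+ (suc n) h k = trans (sum4-cong (λ i → ∑ᶜ-+ n (slice h i) (slice k i)))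
                           (sum4-+ (λ i → ∑ᶜ n (slice h i)) (λ i → ∑ᶜ n (slice k i)))

  ∑ᶜ-* : ∀ n m (h : Colouring n → ℕ) → ∑ᶜ n (λ f → m * h f) ≡ m * ∑ᶜ n h
  ∑ᶜ-* zero    m h = refl
  ∑ᶜ-* (suc n) m h = trans (sum4-cong (λ i → ∑ᶜ-* n m (slice h i)))
                           (sum4-* m (λ i → ∑ᶜ n (slice h i)))

  ∑ᶜ-const : ∀ n m → ∑ᶜ n (λ _ → m) ≡ 4 ^ n * m
  ∑ᶜ-const zero    m = sym (+-identityʳ m)
  ∑ᶜ-const (suc n) m = begin
    sum4 (λ _ → ∑ᶜ n (λ _ → m)) ≡⟨ sum4-const (∑ᶜ n (λ _ → m)) ⟩
    4 * ∑ᶜ n (λ _ → m)          ≡⟨ cong (4 *_) (∑ᶜ-const n m) ⟩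
    4 * (4 ^ n * m)             ≡⟨ *-assoc 4 (4 ^ n) m ⟨
    4 ^ suc n * m               ∎
    where open ≡-Reasoning

  ∑ᶜ-average : ∀ n (h : Colouring n → ℕ) → Σ (Colouring n) λ f → 4 ^ n * h f ≤ ∑ᶜ n h
  ∑ᶜ-average zero    h = [] , ≤-reflexive (+-identityʳ (h []))
  ∑ᶜ-average (suc n) h with sum4-min (λ i → ∑ᶜ n (slice h i))
  ... | i , best with ∑ᶜ-average n (slice h i)
  ... | g , avg = i ∷ g , (begin
    4 ^ suc n * h (i ∷ g)     ≡⟨ *-assoc 4 (4 ^ n) (h (i ∷ g)) ⟩
    4 * (4 ^ n * h (i ∷ g))   ≤⟨ *-monoʳ-≤ 4 avg ⟩
    4 * ∑ᶜ n (slice h i)      ≤⟨ best ⟩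
    ∑ᶜ (suc n) h              ∎)
    where open ≤-Reasoning

module Expectations where
  open import Defs using (VSet; ∣_∣; countTrue)
  open Counting
  open Colourings
  open import Data.Nat
  open import Data.Nat.Properties
  open import Data.Nat.Tactic.RingSolver using (solve-∀)
  open import Data.Fin using (Fin; zero; suc)
  open import Data.Bool using (Bool; true; false; _∧_)
  open import Data.Vec.Functional using (_∷_)
  open import Relation.Binary.PropositionalEquality
  open ≡-Reasoning

  ∑ᶜ-countTrue : ∀ n m (B : Fin m → Colouring n → Bool) K L →
    (∀ v → ∑ᶜ n (λ f → ind (B v f)) * K ≡ L) →
    ∑ᶜ n (λ f → countTrue (λ v → B v f)) * K ≡ m * L
  ∑ᶜ-countTrue n zero B K L each = cong (_* K) (trans (∑ᶜ-const n 0) (*-zeroʳ (4 ^ n)))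
  ∑ᶜ-countTrue n (suc m) B K L each = begin
    ∑ᶜ n (λ f → countTrue (λ v → B v f)) * K
      ≡⟨ cong (_* K) (∑ᶜ-cong n (λ f → countTrue-suc (λ v → B v f))) ⟩
    ∑ᶜ n (λ f → ind (B zero f) + rest f) * K
      ≡⟨ cong (_* K) (∑ᶜ-+ n (λ f → ind (B zero f)) rest) ⟩
    (∑ᶜ n (λ f → ind (B zero f)) + ∑ᶜ n rest) * K
      ≡⟨ *-distribʳ-+ K (∑ᶜ n (λ f → ind (B zero f))) (∑ᶜ n rest) ⟩
    ∑ᶜ n (λ f → ind (B zero f)) * K + ∑ᶜ n rest * K
      ≡⟨ cong₂ _+_ (each zero) (∑ᶜ-countTrue n m (λ v → B (suc v)) K L (λ v → each (suc v))) ⟩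
    L + m * L ∎
    where
    rest : Colouring n → ℕ
    rest f = countTrue (λ v → B (suc v) f)

  ∑ᶜ-chosen-at : ∀ n (v : Fin n) → ∑ᶜ n (λ f → ind (chosen f v)) * 4 ≡ 4 ^ n
  ∑ᶜ-chosen-at (suc n) zero = begin
    sum4 (λ i → ∑ᶜ n (λ _ → ind (isC₀ i))) * 4
      ≡⟨ cong (_* 4) (sum4-cong (λ i → ∑ᶜ-const n (ind (isC₀ i)))) ⟩
    (4 ^ n * 1 + 4 ^ n * 0 + 4 ^ n * 0 + 4 ^ n * 0) * 4
      ≡⟨ lemma (4 ^ n) ⟩
    4 * 4 ^ n ∎
    where
    lemma : ∀ p → (p * 1 + p * 0 + p * 0 + p * 0) * 4 ≡ 4 * p
    lemma = solve-∀
  ∑ᶜ-chosen-at (suc n) (suc v) = begin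
    sum4 (λ _ → ∑ᶜ n (λ g → ind (chosen g v))) * 4
      ≡⟨ cong (_* 4) (sum4-const (∑ᶜ n (λ g → ind (chosen g v)))) ⟩
    4 * ∑ᶜ n (λ g → ind (chosen g v)) * 4
      ≡⟨ *-assoc 4 (∑ᶜ n (λ g → ind (chosen g v))) 4 ⟩
    4 * (∑ᶜ n (λ g → ind (chosen g v)) * 4)
      ≡⟨ cong (4 *_) (∑ᶜ-chosen-at n v) ⟩
    4 * 4 ^ n ∎

  ∑ᶜ-chosen : ∀ n → ∑ᶜ n (λ f → ∣ chosen f ∣) * 4 ≡ n * 4 ^ n
  ∑ᶜ-chosen n = ∑ᶜ-countTrue n n (λ v f → chosen f v) 4 (4 ^ n) (∑ᶜ-chosen-at n)

  -- fewC₀ k c: the number of words of length k over the four colours with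
  -- fewer than c letters c₀.
  fewC₀ : ℕ → ℕ → ℕ
  fewC₀ zero    c       = ind (0 <ᵇ c)
  fewC₀ (suc k) zero    = 0
  fewC₀ (suc k) (suc c) = fewC₀ k c + 3 * fewC₀ k (suc c)

  fewC₀-zero : ∀ k → fewC₀ k 0 ≡ 0
  fewC₀-zero zero    = refl
  fewC₀-zero (suc k) = refl

  fewIn : ∀ n → VSet n → ℕ → ℕ
  fewIn n A c = ∑ᶜ n (λ f → ind (countTrue (λ u → A u ∧ chosen f u) <ᵇ c))

  fewIn-zero : ∀ n A → fewIn n A 0 ≡ 0
  fewIn-zero n A = trans (∑ᶜ-const n 0) (*-zeroʳ (4 ^ n))

  module _ {n} (A : VSet (suc n)) where
    private
      A′ : VSet n
      A′ u = A (suc u)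

      inA′ : Colouring n → ℕ
      inA′ g = countTrue (λ u → A′ u ∧ chosen g u)

      inA-∷ : ∀ {x} → A zero ≡ x → ∀ i g →
        countTrue (λ u → A u ∧ chosen (i ∷ g) u) ≡ ind (x ∧ isC₀ i) + inA′ g
      inA-∷ A₀ i g = trans (countTrue-suc (λ u → A u ∧ chosen (i ∷ g) u))
                           (cong (λ x → ind (x ∧ isC₀ i) + inA′ g) A₀)

    fewIn-outside : ∀ c → A zero ≡ false → fewIn (suc n) A c ≡ 4 * fewIn n A′ c
    fewIn-outside c A₀ = trans
      (sum4-cong (λ i → ∑ᶜ-cong n (λ g →
        cong (λ m → ind (m <ᵇ c)) (inA-∷ A₀ i g))))
      (sum4-const (fewIn n A′ c))

    fewIn-inside : ∀ c → A zero ≡ true →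
      fewIn (suc n) A (suc c) ≡ fewIn n A′ c + 3 * fewIn n A′ (suc c)
    fewIn-inside c A₀ = trans
      (sum4-cong (λ i → ∑ᶜ-cong n (λ g →
        cong (λ m → ind (m <ᵇ suc c)) (inA-∷ A₀ i g))))
      (lemma (fewIn n A′ c) (fewIn n A′ (suc c)))
      where
      lemma : ∀ x y → x + y + y + y ≡ x + 3 * y
      lemma = solve-∀

    size-∷ : ∀ {x} → A zero ≡ x → ∣ A ∣ ≡ ind x + ∣ A′ ∣
    size-∷ A₀ = trans (countTrue-suc A) (cong (λ x → ind x + ∣ A′ ∣) A₀)

  fewIn-tail : ∀ n A c → fewIn n A c * 4 ^ ∣ A ∣ ≡ 4 ^ n * fewC₀ ∣ A ∣ c
  fewIn-tail zero    A c = trans (*-identityʳ _) (sym (+-identityʳ _))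
  fewIn-tail (suc n) A c = byFirst (A zero) refl c
    where
    A′ : VSet n
    A′ u = A (suc u)
    byFirst : ∀ x → A zero ≡ x → ∀ c → fewIn (suc n) A c * 4 ^ ∣ A ∣ ≡ 4 ^ suc n * fewC₀ ∣ A ∣ c
    byFirst false A₀ c = begin
      fewIn (suc n) A c * 4 ^ (∣ A ∣)
        ≡⟨ cong₂ (λ x k → x * 4 ^ k) (fewIn-outside A c A₀) (size-∷ A A₀) ⟩
      4 * fewIn n A′ c * 4 ^ (∣ A′ ∣)
        ≡⟨ *-assoc 4 (fewIn n A′ c) _ ⟩
      4 * (fewIn n A′ c * 4 ^ (∣ A′ ∣))
        ≡⟨ cong (4 *_) (fewIn-tail n A′ c) ⟩
      4 * (4 ^ n * fewC₀ (∣ A′ ∣) c)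
        ≡⟨ *-assoc 4 (4 ^ n) _ ⟨
      4 ^ suc n * fewC₀ (∣ A′ ∣) c
        ≡⟨ cong (λ k → 4 ^ suc n * fewC₀ k c) (size-∷ A A₀) ⟨
      4 ^ suc n * fewC₀ (∣ A ∣) c ∎
    byFirst true A₀ zero = begin
      fewIn (suc n) A 0 * 4 ^ (∣ A ∣)
        ≡⟨ cong (_* 4 ^ ∣ A ∣) (fewIn-zero (suc n) A) ⟩
      0
        ≡⟨ *-zeroʳ (4 ^ suc n) ⟨
      4 ^ suc n * 0
        ≡⟨ cong (4 ^ suc n *_) (fewC₀-zero ∣ A ∣) ⟨
      4 ^ suc n * fewC₀ (∣ A ∣) 0 ∎
    byFirst true A₀ (suc c) = begin
      fewIn (suc n) A (suc c) * 4 ^ (∣ A ∣)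
        ≡⟨ cong₂ (λ x k → x * 4 ^ k) (fewIn-inside A c A₀) (size-∷ A A₀) ⟩
      (fewIn n A′ c + 3 * fewIn n A′ (suc c)) * (4 * p)
        ≡⟨ distribute (fewIn n A′ c) (fewIn n A′ (suc c)) p ⟩
      4 * (fewIn n A′ c * p) + 12 * (fewIn n A′ (suc c) * p)
        ≡⟨ cong₂ (λ x y → 4 * x + 12 * y) (fewIn-tail n A′ c) (fewIn-tail n A′ (suc c)) ⟩
      4 * (4 ^ n * fewC₀ (∣ A′ ∣) c) + 12 * (4 ^ n * fewC₀ (∣ A′ ∣) (suc c))
        ≡⟨ collect (4 ^ n) (fewC₀ (∣ A′ ∣) c) (fewC₀ (∣ A′ ∣) (suc c)) ⟩
      4 ^ suc n * fewC₀ (suc ∣ A′ ∣) (suc c)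
        ≡⟨ cong (λ k → 4 ^ suc n * fewC₀ k (suc c)) (size-∷ A A₀) ⟨
      4 ^ suc n * fewC₀ (∣ A ∣) (suc c) ∎
      where
      p : ℕ
      p = 4 ^ (∣ A′ ∣)
      distribute : ∀ x y p → (x + 3 * y) * (4 * p) ≡ 4 * (x * p) + 12 * (y * p)
      distribute = solve-∀
      collect : ∀ q d e → 4 * (q * d) + 12 * (q * e) ≡ 4 * q * (d + 3 * e)
      collect = solve-∀

module TailBound where
  open Counting using (ind≤1)
  open Expectations using (fewC₀; fewC₀-zero)
  open import Data.Nat
  open import Data.Nat.Properties
  open import Data.Nat.Tactic.RingSolver using (solve-∀)
  open import Data.Product using (Σ; _,_)
  open import Relation.Binary.PropositionalEquality
  open ≤-Reasoning

  fewC₀≤4^ : ∀ k c → fewC₀ k c ≤ 4 ^ k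
  fewC₀≤4^ zero    c       = ind≤1 (0 <ᵇ c)
  fewC₀≤4^ (suc k) zero    = z≤n
  fewC₀≤4^ (suc k) (suc c) = begin
    fewC₀ k c + 3 * fewC₀ k (suc c)
      ≤⟨ +-mono-≤ (fewC₀≤4^ k c) (*-monoʳ-≤ 3 (fewC₀≤4^ k (suc c))) ⟩
    4 ^ k + 3 * 4 ^ k
      ≡⟨ lemma (4 ^ k) ⟩
    4 * 4 ^ k ∎
    where
    lemma : ∀ p → p + 3 * p ≡ 4 * p
    lemma = solve-∀

  3^t*[3+t]≤3*4^t : ∀ t → 3 ^ t * (3 + t) ≤ 3 * 4 ^ t
  3^t*[3+t]≤3*4^t zero    = ≤-refl
  3^t*[3+t]≤3*4^t (suc t) = begin
    3 * 3 ^ t * (3 + suc t)              ≡⟨ lemma (3 ^ t) t ⟩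
    3 * (3 ^ t * (3 + t)) + 3 * 3 ^ t    ≤⟨ +-mono-≤ (*-monoʳ-≤ 3 (3^t*[3+t]≤3*4^t t))
                                                     (*-monoʳ-≤ 3 (^-monoˡ-≤ t (n≤1+n 3))) ⟩
    3 * (3 * 4 ^ t) + 3 * 4 ^ t          ≡⟨ lemma′ (4 ^ t) ⟩
    3 * (4 * 4 ^ t)                      ∎
    where
    lemma : ∀ p t → 3 * p * (3 + suc t) ≡ 3 * (p * (3 + t)) + 3 * p
    lemma = solve-∀
    lemma′ : ∀ q → 3 * (3 * q) + 3 * q ≡ 3 * (4 * q)
    lemma′ = solve-∀

  3^t*2M≤4^t : ∀ M t → 6 * M ≤ t → 3 ^ t * (2 * M) ≤ 4 ^ t
  3^t*2M≤4^t M t 6M≤t = *-cancelˡ-≤ 3 (begin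
    3 * (3 ^ t * (2 * M))  ≡⟨ lemma (3 ^ t) M ⟩
    3 ^ t * (6 * M)        ≤⟨ *-monoʳ-≤ (3 ^ t) (≤-trans 6M≤t (m≤n+m t 3)) ⟩
    3 ^ t * (3 + t)        ≤⟨ 3^t*[3+t]≤3*4^t t ⟩
    3 * 4 ^ t              ∎)
    where
    lemma : ∀ p M → 3 * (p * (2 * M)) ≡ p * (6 * M)
    lemma = solve-∀

  -- Unrolling the recurrence of fewC₀ from length R, where the bound for c is
  -- already available with constant 2M: the error term decays like (3/4)^t.
  fewC₀-unroll : ∀ c M R → (∀ r → R ≤ r → 2 * M * fewC₀ r c ≤ 4 ^ r) →
    ∀ t → 2 * M * fewC₀ (R + t) (suc c) ≤ 4 ^ (R + t) + 3 ^ t * (2 * M * 4 ^ R)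
  fewC₀-unroll c M R bound zero rewrite +-identityʳ R = begin
    2 * M * fewC₀ R (suc c)   ≤⟨ *-monoʳ-≤ (2 * M) (fewC₀≤4^ R (suc c)) ⟩
    2 * M * 4 ^ R             ≤⟨ m≤n+m _ (4 ^ R) ⟩
    4 ^ R + 2 * M * 4 ^ R     ≡⟨ cong (4 ^ R +_) (+-identityʳ _) ⟨
    4 ^ R + (2 * M * 4 ^ R + 0) ∎
  fewC₀-unroll c M R bound (suc t) rewrite +-suc R t = begin
    2 * M * (fewC₀ (R + t) c + 3 * fewC₀ (R + t) (suc c))
      ≡⟨ lemma (2 * M) (fewC₀ (R + t) c) (fewC₀ (R + t) (suc c)) ⟩
    2 * M * fewC₀ (R + t) c + 3 * (2 * M * fewC₀ (R + t) (suc c))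
      ≤⟨ +-mono-≤ (bound (R + t) (m≤m+n R t)) (*-monoʳ-≤ 3 (fewC₀-unroll c M R bound t)) ⟩
    4 ^ (R + t) + 3 * (4 ^ (R + t) + 3 ^ t * K)
      ≡⟨ lemma′ (4 ^ (R + t)) (3 ^ t) K ⟩
    4 * 4 ^ (R + t) + 3 * 3 ^ t * K ∎
    where
    K : ℕ
    K = 2 * M * 4 ^ R
    lemma : ∀ a x y → a * (x + 3 * y) ≡ a * x + 3 * (a * y)
    lemma = solve-∀
    lemma′ : ∀ p q k → p + 3 * (p + q * k) ≡ 4 * p + 3 * q * k
    lemma′ = solve-∀

  fewC₀-small : ∀ c M → Σ ℕ λ R → ∀ r → R ≤ r → M * fewC₀ r c ≤ 4 ^ r
  fewC₀-small zero M = 0 , λ r _ → subst (_≤ 4 ^ r) (sym (noWords r)) z≤n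
    where
    noWords : ∀ r → M * fewC₀ r 0 ≡ 0
    noWords r = trans (cong (M *_) (fewC₀-zero r)) (*-zeroʳ M)
  fewC₀-small (suc c) M with fewC₀-small c (2 * M)
  ... | R , bound = R + 6 * M , large
    where
    large : ∀ r → R + 6 * M ≤ r → M * fewC₀ r (suc c) ≤ 4 ^ r
    large r R+6M≤r = *-cancelˡ-≤ 2 (begin
      2 * (M * fewC₀ r (suc c))
        ≡⟨ *-assoc 2 M _ ⟨
      2 * M * fewC₀ r (suc c)
        ≡⟨ cong (λ k → 2 * M * fewC₀ k (suc c)) r≡R+t ⟩
      2 * M * fewC₀ (R + t) (suc c)
        ≤⟨ fewC₀-unroll c M R bound t ⟩
      4 ^ (R + t) + 3 ^ t * (2 * M * 4 ^ R)
        ≡⟨ cong (4 ^ (R + t) +_) (*-assoc (3 ^ t) (2 * M) (4 ^ R)) ⟨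
      4 ^ (R + t) + 3 ^ t * (2 * M) * 4 ^ R
        ≤⟨ +-monoʳ-≤ (4 ^ (R + t)) (*-monoˡ-≤ (4 ^ R) (3^t*2M≤4^t M t 6M≤t)) ⟩
      4 ^ (R + t) + 4 ^ t * 4 ^ R
        ≡⟨ cong (4 ^ (R + t) +_) (trans (*-comm (4 ^ t) (4 ^ R)) (sym (^-distribˡ-+-* 4 R t))) ⟩
      4 ^ (R + t) + 4 ^ (R + t)
        ≡⟨ cong (λ k → 4 ^ k + 4 ^ k) r≡R+t ⟨
      4 ^ r + 4 ^ r
        ≡⟨ cong (4 ^ r +_) (+-identityʳ (4 ^ r)) ⟨
      2 * 4 ^ r ∎)
      where
      t : ℕ
      t = r ∸ R
      r≡R+t : r ≡ R + t
      r≡R+t = sym (m+[n∸m]≡n (≤-trans (m≤m+n R (6 * M)) R+6M≤r))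
      6M≤t : 6 * M ≤ t
      6M≤t = ≤-trans (≤-reflexive (sym (m+n∸m≡n R (6 * M)))) (∸-monoˡ-≤ R R+6M≤r)

module DenseSet where
  open import Defs using (Graph; adj; VSet; ∣_∣; degree; nbrsIn; Regular)
  open Counting using (ind)
  open Repair using (deficient; repair)
  open Colourings using (Colouring; chosen; ∑ᶜ; ∑ᶜ-+; ∑ᶜ-*; ∑ᶜ-average)
  open Expectations using (∑ᶜ-countTrue; ∑ᶜ-chosen; fewC₀; fewIn; fewIn-tail)
  open TailBound using (fewC₀-small)
  open import Data.Nat
  open import Data.Nat.Properties
  open import Data.Nat.Tactic.RingSolver using (solve-∀)
  open import Data.Product using (Σ; _×_; _,_)
  open import Relation.Binary.PropositionalEquality

  module _ {n} (G : Graph n) (c : ℕ) where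

    -- Twice the size of the set obtained by repairing the c₀-coloured set of f.
    weight : Colouring n → ℕ
    weight f = 2 * ∣ chosen f ∣ + 2 * c * ∣ deficient G c (chosen f) ∣

    ∑ᶜ-deficient : ∀ r → Regular r G →
      ∑ᶜ n (λ f → ∣ deficient G c (chosen f) ∣) * 4 ^ r ≡ n * (4 ^ n * fewC₀ r c)
    ∑ᶜ-deficient r reg =
      ∑ᶜ-countTrue n n (λ v f → deficient G c (chosen f) v) (4 ^ r) (4 ^ n * fewC₀ r c) perVertex
      where
      perVertex : ∀ v → ∑ᶜ n (λ f → ind (deficient G c (chosen f) v)) * 4 ^ r ≡ 4 ^ n * fewC₀ r c
      perVertex v = subst (λ k → fewIn n (adj G v) c * 4 ^ k ≡ 4 ^ n * fewC₀ k c)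
                          (reg v) (fewIn-tail n (adj G v) c)

    ∑ᶜ-weight≤ : ∀ r → Regular r G → 4 * c * fewC₀ r c ≤ 4 ^ r → ∑ᶜ n weight ≤ 4 ^ n * n
    ∑ᶜ-weight≤ r reg small = *-cancelˡ-≤ (4 ^ suc r) {{m^n≢0 4 (suc r)}} (begin
      4 * Q * ∑ᶜ n weight
        ≡⟨ cong (4 * Q *_) linearity ⟩
      4 * Q * (2 * X + 2 * c * Y)
        ≡⟨ expand Q X c Y ⟩
      2 * Q * (X * 4) + 8 * c * (Y * Q)
        ≡⟨ cong₂ (λ x y → 2 * Q * x + 8 * c * y) (∑ᶜ-chosen n) (∑ᶜ-deficient r reg) ⟩
      2 * Q * (n * P) + 8 * c * (n * (P * d))
        ≡⟨ regroup Q n P c d ⟩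
      2 * Q * (n * P) + 2 * n * P * (4 * c * d)
        ≤⟨ +-monoʳ-≤ (2 * Q * (n * P)) (*-monoʳ-≤ (2 * n * P) small) ⟩
      2 * Q * (n * P) + 2 * n * P * Q
        ≡⟨ collect Q n P ⟩
      4 * Q * (P * n) ∎)
      where
      open ≤-Reasoning
      P Q d X Y : ℕ
      P = 4 ^ n
      Q = 4 ^ r
      d = fewC₀ r c
      X = ∑ᶜ n (λ f → ∣ chosen f ∣)
      Y = ∑ᶜ n (λ f → ∣ deficient G c (chosen f) ∣)
      linearity : ∑ᶜ n weight ≡ 2 * X + 2 * c * Y
      linearity = trans (∑ᶜ-+ n _ _) (cong₂ _+_ (∑ᶜ-* n 2 _) (∑ᶜ-* n (2 * c) _))
      expand : ∀ Q X c Y → 4 * Q * (2 * X + 2 * c * Y) ≡ 2 * Q * (X * 4) + 8 * c * (Y * Q)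
      expand = solve-∀
      regroup : ∀ Q n P c d →
        2 * Q * (n * P) + 8 * c * (n * (P * d)) ≡ 2 * Q * (n * P) + 2 * n * P * (4 * c * d)
      regroup = solve-∀
      collect : ∀ Q n P → 2 * Q * (n * P) + 2 * n * P * Q ≡ 4 * Q * (P * n)
      collect = solve-∀

  halfDenseSet : ∀ c → Σ ℕ λ R → ∀ r → R ≤ r → ∀ n (G : Graph n) → Regular r G →
    Σ (VSet n) λ S → (∀ v → c ≤ nbrsIn G S v) × 2 * ∣ S ∣ ≤ n
  halfDenseSet c with fewC₀-small c (4 * c)
  ... | R , small = R + c , dense
    where
    dense : ∀ r → R + c ≤ r → ∀ n (G : Graph n) → Regular r G →
      Σ (VSet n) λ S → (∀ v → c ≤ nbrsIn G S v) × 2 * ∣ S ∣ ≤ n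
    dense r R+c≤r n G reg with ∑ᶜ-average n (weight G c)
    ... | f , belowAverage with repair G c (chosen f) degree≥c
      where
      degree≥c : ∀ v → c ≤ degree G v
      degree≥c v = subst (c ≤_) (sym (reg v)) (≤-trans (m≤n+m c R) R+c≤r)
    ... | S , ok , size = S , ok , (begin
      2 * ∣ S ∣                                              ≤⟨ *-monoʳ-≤ 2 size ⟩
      2 * (∣ chosen f ∣ + c * ∣ deficient G c (chosen f) ∣)  ≡⟨ double ∣ chosen f ∣ c _ ⟩
      weight G c f                                           ≤⟨ goodColouring ⟩
      n                                                      ∎)
      where
      open ≤-Reasoning
      double : ∀ a c b → 2 * (a + c * b) ≡ 2 * a + 2 * c * b
      double = solve-∀
      goodColouring : weight G c f ≤ n
      goodColouring = *-cancelˡ-≤ (4 ^ n) {{m^n≢0 4 n}}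
        (≤-trans belowAverage (∑ᶜ-weight≤ G c r reg (small r (≤-trans (m≤m+n R c) R+c≤r))))

module HalfBound where
  open import Data.Nat as ℕ using (ℕ)
  import Data.Nat.Properties as ℕ
  open import Data.Nat.Coprimality using (1-coprimeTo) renaming (sym to coprime-sym)
  open import Data.Integer as ℤ using (+_; +≤+)
  import Data.Integer.Properties as ℤ
  open import Data.Rational using (ℚ; mkℚ; _/_; _*_; ½; _≤_)
  open import Data.Rational.Properties
    using (↥p/↧p≡p; toℚᵘ-cancel-≤; toℚᵘ-homo-*; *-monoʳ-≤-nonNeg; ≤-trans)
  import Data.Rational.Unnormalised as ℚᵘ
  import Data.Rational.Unnormalised.Properties as ℚᵘ
  open import Relation.Binary.PropositionalEquality

  ℕ→ℚ : ℕ → ℚ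
  ℕ→ℚ k = mkℚ (+ k) 0 (coprime-sym (1-coprimeTo k))

  /1≡ℕ→ℚ : ∀ k → (+ k) / 1 ≡ ℕ→ℚ k
  /1≡ℕ→ℚ k = ↥p/↧p≡p (ℕ→ℚ k)

  ≤half : ∀ s n → 2 ℕ.* s ℕ.≤ n → ℕ→ℚ s ≤ ½ * ℕ→ℚ n
  ≤half s n 2s≤n =
    toℚᵘ-cancel-≤ (ℚᵘ.≤-respʳ-≃ (ℚᵘ.≃-sym (toℚᵘ-homo-* ½ (ℕ→ℚ n))) (ℚᵘ.*≤* cross))
    where
    cross : + s ℤ.* + 2 ℤ.≤ (+ 1 ℤ.* + n) ℤ.* + 1
    cross = subst₂ ℤ._≤_ (ℤ.pos-* s 2)
              (sym (trans (ℤ.*-identityʳ (+ 1 ℤ.* + n)) (ℤ.*-identityˡ (+ n))))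
              (+≤+ (subst (ℕ._≤ n) (ℕ.*-comm 2 s) 2s≤n))

  halfBound : ∀ s n → 2 ℕ.* s ℕ.≤ n → (α : ℚ) → ½ ≤ α → (+ s) / 1 ≤ α * ((+ n) / 1)
  halfBound s n 2s≤n α ½≤α rewrite /1≡ℕ→ℚ s | /1≡ℕ→ℚ n =
    ≤-trans (≤half s n 2s≤n) (*-monoʳ-≤-nonNeg (ℕ→ℚ n) ½≤α)

open import Defs
open import Data.Nat using (ℕ; _≥_; _>_)
open import Data.Integer using (+_)
open import Data.Rational using (ℚ; _/_; _*_; ½; 1ℚ; _≤_; _<_)
open import Data.Product using (_×_; _,_; ∃-syntax)

import Data.Nat as ℕ
import Data.Nat.Properties as ℕ
open DenseSet using (halfDenseSet)
open HalfBound using (halfBound)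

dense⇒dominating : ∀ a b {n} (G : Graph n) S → (∀ v → a ℕ.+ b ℕ.≤ nbrsIn G S v) →
  IsABDominating a b G S
dense⇒dominating a b G S dense v =
  (λ _ → ℕ.≤-trans (ℕ.m≤m+n a b) (dense v)) , (λ _ → ℕ.≤-trans (ℕ.m≤n+m b a) (dense v))

mainTheorem7 : (a b : ℕ) → a > 0 → b > 0 → (α : ℚ) → ½ ≤ α → α < 1ℚ →
    ∃[ r₀ ] (r₀ > 0 × (∀ (r : ℕ) → r ≥ r₀ → ∀ (n : ℕ) (G : Graph n) → Regular r G →
      ∃[ S ] (IsABDominating a b G S × ((+ ∣ S ∣) / 1 ≤ α * ((+ n) / 1)))))
mainTheorem7 a b _ _ α ½≤α _ =
  let (R , dense) = halfDenseSet (a ℕ.+ b) in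
  ℕ.suc R , ℕ.s≤s ℕ.z≤n , λ r r>R n G reg →
    let (S , enough , half) = dense r (ℕ.<⇒≤ r>R) n G reg in
    S , dense⇒dominating a b G S enough , halfBound ∣ S ∣ n half α ½≤α
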